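{- Let $G=(V,E)$ be a graph of neighborhood diversity $w$ with a vertex partition $V=W_1\,\dot\cup\,\cdots\,\dot\cup\, W_w$ into true twin classes. If $G$ admits a $k$-Grundy coloring, then there is a $k$-Grundy coloring $V_1\,\dot\cup\,\cdots\,\dot\cup\, V_k$ with the following property: for all $j_1,j_2\in[k]$ such that $\{\ell\in[w]: V_{j_1}\cap W_\ell\ne\emptyset\}=\{\ell\in[w]: V_{j_2}\cap W_\ell\ne\emptyset\}$, every $j_3\in[k]$ with $j_1\le j_3\le j_2$ satisfies $\{\ell\in[w]: V_{j_3}\cap W_\ell\ne\emptyset\}=\{\ell\in[w]: V_{j_1}\cap W_\ell\ne\emptyset\}$.
   Context: A $k$-Grundy coloring of a graph $(V,E)$ is a partition of $V$ into $k$ non-empty independent sets $V_1,\ldots,V_k$ (in this order) such that for each $i\in[k-1]$ every vertex of $\bigcup_{j>i}V_j$ has a neighbor in $V_i$. Two vertices $u,v$ are twins if $N(u)\setminus\{v\}=N(v)\setminus\{u\}$, true twins if moreover adjacent. A twin class is a maximal set of pairwise twins; a true twin class is a twin class that is a clique (possibly a singleton). $G$ has neighborhood diversity $w$ if $V$ can be partitioned into at most $w$ twin classes. -}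

module Defs where

open import Data.Nat using (ℕ)
open import Data.Fin using (Fin; toℕ; _≤_) renaming (_<_ to _<ᶠ_)
open import Data.Product using (Σ; ∃; _×_; _,_)
open import Relation.Nullary using (¬_)
open import Relation.Binary.PropositionalEquality using (_≡_; _≢_)
open import Function.Bundles using (_⇔_)

record Graph (n : ℕ) : Set₁ where
  field
    Adj   : Fin n → Fin n → Set
    sym   : ∀ {u v} → Adj u v → Adj v u
    irrefl : ∀ {v} → ¬ Adj v v
open Graph public

module _ {n : ℕ} (G : Graph n) where

  Twins : Fin n → Fin n → Set
  Twins u v = ∀ x → (Adj G u x × x ≢ v) ⇔ (Adj G v x × x ≢ u)

  -- A partition of V into w classes W_ℓ = t⁻¹(ℓ), each of which is a true twin
  -- class: non-empty, pairwise twins, a clique, and maximal with respect to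
  -- being a set of pairwise twins.
  record TrueTwinPartition (w : ℕ) (t : Fin n → Fin w) : Set where
    field
      nonempty : ∀ ℓ → ∃ λ v → t v ≡ ℓ
      twins    : ∀ u v → t u ≡ t v → Twins u v
      clique   : ∀ u v → t u ≡ t v → u ≢ v → Adj G u v
      maximal  : ∀ ℓ v → (∀ u → t u ≡ ℓ → u ≢ v → Twins u v) → t v ≡ ℓ

  -- A k-Grundy coloring: V_i = c⁻¹(i), i ∈ Fin k (ordered by index).
  record IsGrundy (k : ℕ) (c : Fin n → Fin k) : Set where
    field
      nonempty    : ∀ i → ∃ λ v → c v ≡ i
      independent : ∀ u v → Adj G u v → c u ≢ c v
      grundy      : ∀ i v → i <ᶠ c v → ∃ λ u → Adj G v u × c u ≡ i

  Meets : ∀ {w k} → (Fin n → Fin w) → (Fin n → Fin k) → Fin k → Fin w → Set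
  Meets t c j ℓ = ∃ λ v → c v ≡ j × t v ≡ ℓ

  SameTypes : ∀ {w k} → (Fin n → Fin w) → (Fin n → Fin k) → Fin k → Fin k → Set
  SameTypes t c j₁ j₂ = ∀ ℓ → Meets t c j₁ ℓ ⇔ Meets t c j₂ ℓ

-- Start from any k-Grundy colouring c and give every colour m the key
-- first(m) = the least colour of the same type as m.  Re-order the colours
-- by (first(m), m) lexicographically; then colours of equal type form an
-- interval.  The re-ordered colouring is still Grundy: if m now precedes
-- the colour of v but came after it before, then first(m) < colour of v, so v
-- has a neighbour u of colour first(m); since m has the same type, some u'
-- of colour m lies in the twin class of u, and twins share neighbours.
module Submission where

open import Defs
open import Data.Nat using (ℕ)
open import Data.Fin using (Fin; _≤_)
open import Data.Product using (Σ; ∃; _×_; _,_)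

open import Level using (0ℓ)
open import Data.Nat as ℕ using (zero; suc)
import Data.Nat.Properties as ℕ
open import Data.Fin using (zero; suc; fromℕ<; _<_; punchOut)
open import Data.Fin.Properties
  using (_≟_; any?; all?; toℕ-fromℕ<; punchOut-injective; injective⇒≤; <-cmp; <-irrefl; <-asym; ≤-antisym)
open import Data.Fin.Permutation using (Permutation′; permutation; _⟨$⟩ʳ_; _⟨$⟩ˡ_; inverseʳ; inverseˡ)
open import Data.Product using (proj₁; proj₂)
open import Data.Sum using (_⊎_; inj₁; inj₂)
open import Data.Bool using (if_then_else_)
open import Data.Unit using (tt)
open import Data.Empty using (⊥-elim)
open import Function using (_∘_)
open import Function.Bundles using (_⇔_; mk⇔; Equivalence)
open import Function.Definitions using (Injective)
open import Function.Properties.Equivalence using (⇔-isEquivalence)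
open import Function.Construct.Composition using (_⇔-∘_)
open import Function.Construct.Symmetry using (⇔-sym)
open import Relation.Nullary using (¬_; Dec; yes; no; does)
open import Relation.Nullary.Decidable using (map′; _×-dec_; _→-dec_)
open import Relation.Unary using (Pred; Decidable; _⊆_)
open import Relation.Unary.Properties using (U?)
open import Relation.Binary using (Rel; IsEquivalence; IsStrictTotalOrder; Trichotomous; tri<; tri≈; tri>)
open import Relation.Binary.PropositionalEquality as ≡ using (_≡_; _≢_; refl; cong; subst; subst₂)
open Equivalence using (to; from)

count : ∀ {k p} {P : Pred (Fin k) p} → Decidable P → ℕ
count {zero}  P? = 0
count {suc k} P? = (if does (P? zero) then 1 else 0) ℕ.+ count (P? ∘ suc)

count-mono : ∀ {k p q} {P : Pred (Fin k) p} {Q : Pred (Fin k) q}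
  (P? : Decidable P) (Q? : Decidable Q) → P ⊆ Q → count P? ℕ.≤ count Q?
count-mono {zero}  P? Q? P⊆Q = ℕ.z≤n
count-mono {suc k} P? Q? P⊆Q with P? zero | Q? zero | count-mono (P? ∘ suc) (Q? ∘ suc) P⊆Q
... | yes _ | yes _ | rest = ℕ.s≤s rest
... | yes p | no ¬q | _    = ⊥-elim (¬q (P⊆Q p))
... | no _  | yes _ | rest = ℕ.m≤n⇒m≤1+n rest
... | no _  | no _  | rest = rest

count-strict : ∀ {k p q} {P : Pred (Fin k) p} {Q : Pred (Fin k) q}
  (P? : Decidable P) (Q? : Decidable Q) → P ⊆ Q → ∀ x → Q x → ¬ P x → count P? ℕ.< count Q?
count-strict {suc k} P? Q? P⊆Q zero qx ¬px with P? zero | Q? zero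
... | yes p | _     = ⊥-elim (¬px p)
... | no _  | yes _ = ℕ.s≤s (count-mono (P? ∘ suc) (Q? ∘ suc) P⊆Q)
... | no _  | no ¬q = ⊥-elim (¬q qx)
count-strict {suc k} P? Q? P⊆Q (suc x) qx ¬px
  with P? zero | Q? zero | count-strict (P? ∘ suc) (Q? ∘ suc) P⊆Q x qx ¬px
... | yes _ | yes _ | rest = ℕ.s≤s rest
... | yes p | no ¬q | _    = ⊥-elim (¬q (P⊆Q p))
... | no _  | yes _ | rest = ℕ.m<n⇒m<1+n rest
... | no _  | no _  | rest = rest

count-U : ∀ k → count {k} U? ≡ k
count-U zero    = refl
count-U (suc k) = cong suc (count-U k)

least : ∀ {k p} {P : Pred (Fin k) p} → Decidable P → ∃ P → ∃ λ i → P i × (∀ {j} → P j → i ≤ j)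
least {suc k} P? x with P? zero
least {suc k} P? x             | yes p₀ = zero , p₀ , λ _ → ℕ.z≤n
least {suc k} P? (zero , px)   | no ¬p₀ = ⊥-elim (¬p₀ px)
least {suc k} {P = P} P? (suc x , px) | no ¬p₀ with least (P? ∘ suc) (x , px)
... | i , pi , i-least = suc i , pi , suc-least
  where
  suc-least : ∀ {j} → P j → suc i ≤ j
  suc-least {zero}  p₀ = ⊥-elim (¬p₀ p₀)
  suc-least {suc j} pj = ℕ.s≤s (i-least pj)

-- An injective map Fin k → Fin k is onto: otherwise, punching out a missed
-- value would give an injection Fin k → Fin (k - 1).
injective⇒onto : ∀ {k} {h : Fin k → Fin k} → Injective _≡_ _≡_ h → ∀ i → ∃ λ a → h a ≡ i
injective⇒onto {suc k} {h} h-inj i with any? (λ a → h a ≟ i)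
... | yes hit = hit
... | no ¬hit = ⊥-elim (ℕ.1+n≰n (injective⇒≤ squeeze-injective))
  where
  misses : ∀ a → i ≢ h a
  misses a i≡ha = ¬hit (a , ≡.sym i≡ha)

  squeeze : Fin (suc k) → Fin k
  squeeze a = punchOut (misses a)

  squeeze-injective : Injective _≡_ _≡_ squeeze
  squeeze-injective {a} {b} e = h-inj (punchOut-injective (misses a) (misses b) e)

module Rank {k ℓ} {_≺_ : Rel (Fin k) ℓ} (isSTO : IsStrictTotalOrder _≡_ _≺_) where
  open IsStrictTotalOrder isSTO renaming (_<?_ to _≺?_; irrefl to ≺-irrefl; trans to ≺-trans)

  rank : Fin k → ℕ
  rank a = count (_≺? a)

  rank-mono : ∀ {a b} → a ≺ b → rank a ℕ.< rank b
  rank-mono {a} a≺b = count-strict (_≺? a) (_≺? _) (λ m≺a → ≺-trans m≺a a≺b) a a≺b (≺-irrefl refl)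

  -- a itself is never below a, so fewer than k elements are.
  rank<k : ∀ a → rank a ℕ.< k
  rank<k a = subst (rank a ℕ.<_) (count-U k) (count-strict (_≺? a) U? (λ _ → tt) a tt (≺-irrefl refl))

  position : Fin k → Fin k
  position a = fromℕ< (rank<k a)

  position-mono : ∀ {a b} → a ≺ b → position a < position b
  position-mono {a} {b} a≺b =
    subst₂ ℕ._<_ (≡.sym (toℕ-fromℕ< (rank<k a))) (≡.sym (toℕ-fromℕ< (rank<k b))) (rank-mono a≺b)

  position-reflect : ∀ {a b} → position a < position b → a ≺ b
  position-reflect {a} {b} lt with compare a b
  ... | tri< a≺b _ _ = a≺b
  ... | tri≈ _ refl _ = ⊥-elim (<-irrefl refl lt)
  ... | tri> _ _ b≺a = ⊥-elim (<-asym lt (position-mono b≺a))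

  position-injective : Injective _≡_ _≡_ position
  position-injective {a} {b} e with compare a b
  ... | tri< a≺b _ _ = ⊥-elim (<-irrefl e (position-mono a≺b))
  ... | tri≈ _ a≡b _ = a≡b
  ... | tri> _ _ b≺a = ⊥-elim (<-irrefl (≡.sym e) (position-mono b≺a))

sortingPermutation : ∀ {k ℓ} {_≺_ : Rel (Fin k) ℓ} → IsStrictTotalOrder _≡_ _≺_
  → Σ (Permutation′ k) λ π → ∀ {a b} → a ≺ b ⇔ (π ⟨$⟩ʳ a) < (π ⟨$⟩ʳ b)
sortingPermutation {k} isSTO =
  permutation position unposition (λ i → proj₂ (onto i)) (λ a → position-injective (proj₂ (onto (position a))))
  , mk⇔ position-mono position-reflect
  where
  open Rank isSTO

  onto : ∀ i → ∃ λ a → position a ≡ i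
  onto = injective⇒onto position-injective

  unposition : Fin k → Fin k
  unposition i = proj₁ (onto i)

module KeyOrder {k m} (key : Fin k → Fin m) where

  infix 4 _≺_
  _≺_ : Rel (Fin k) 0ℓ
  a ≺ b = key a < key b ⊎ (key a ≡ key b × a < b)

  ≺-isStrictTotalOrder : IsStrictTotalOrder _≡_ _≺_
  ≺-isStrictTotalOrder = record
    { isStrictPartialOrder = record
      { isEquivalence = ≡.isEquivalence
      ; irrefl        = ≺-irrefl
      ; trans         = ≺-trans
      ; <-resp-≈      = ≡.resp₂ _≺_
      }
    ; compare = ≺-compare
    }
    where
    ≺-irrefl : ∀ {a b} → a ≡ b → ¬ a ≺ b
    ≺-irrefl refl (inj₁ lt)       = <-irrefl refl lt
    ≺-irrefl refl (inj₂ (_ , lt)) = <-irrefl refl lt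

    ≺-trans : ∀ {a b d} → a ≺ b → b ≺ d → a ≺ d
    ≺-trans (inj₁ p)       (inj₁ q)        = inj₁ (ℕ.<-trans p q)
    ≺-trans (inj₁ p)       (inj₂ (e , _))  = inj₁ (subst (key _ <_) e p)
    ≺-trans (inj₂ (e , _)) (inj₁ q)        = inj₁ (subst (_< key _) (≡.sym e) q)
    ≺-trans (inj₂ (e , p)) (inj₂ (e' , q)) = inj₂ (≡.trans e e' , ℕ.<-trans p q)

    ≺-compare : Trichotomous _≡_ _≺_
    ≺-compare a b with <-cmp (key a) (key b) | <-cmp a b
    ... | tri< p ¬q ¬r | _ = tri< (inj₁ p) (λ { refl → ¬q refl })
                                 λ { (inj₁ r) → ¬r r ; (inj₂ (e , _)) → ¬q (≡.sym e) }
    ... | tri> ¬p ¬q r | _ = tri> (λ { (inj₁ p) → ¬p p ; (inj₂ (e , _)) → ¬q e })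
                                 (λ { refl → ¬q refl }) (inj₁ r)
    ... | tri≈ _ e ¬r | tri< p' ¬q' ¬r' = tri< (inj₂ (e , p')) ¬q'
                                 λ { (inj₁ r) → ¬r r ; (inj₂ (_ , r')) → ¬r' r' }
    ... | tri≈ _ _ _ | tri≈ _ e' _ = tri≈ (≺-irrefl e') e' (≺-irrefl (≡.sym e'))
    ... | tri≈ ¬p e _ | tri> ¬p' ¬q' r' = tri> (λ { (inj₁ p) → ¬p p ; (inj₂ (_ , p')) → ¬p' p' })
                                 ¬q' (inj₂ (≡.sym e , r'))

  key-block : ∀ {a₁ a₂ a₃} → key a₁ ≡ key a₂ → ¬ a₃ ≺ a₁ → ¬ a₂ ≺ a₃ → key a₃ ≡ key a₁
  key-block {a₁} {a₂} {a₃} e a₁≼a₃ a₃≼a₂ with <-cmp (key a₃) (key a₁)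
  ... | tri< lt _ _ = ⊥-elim (a₁≼a₃ (inj₁ lt))
  ... | tri≈ _ eq _ = eq
  ... | tri> _ _ gt = ⊥-elim (a₃≼a₂ (inj₁ (subst (_< key a₃) e gt)))

module _ {n} (G : Graph n) where

  twin-adjacent : ∀ {w} {t : Fin n → Fin w} → TrueTwinPartition G w t
    → ∀ {u u' v} → t u ≡ t u' → Adj G v u → v ≢ u' → Adj G v u'
  twin-adjacent TT {u} {u'} {v} tu≡tu' vu v≢u' =
    Graph.sym G (proj₁ (to (TrueTwinPartition.twins TT u u' tu≡tu' v) (Graph.sym G vu , v≢u')))

  sameTypes-isEquivalence : ∀ {w k} (t : Fin n → Fin w) (c : Fin n → Fin k)
    → IsEquivalence (SameTypes G t c)
  sameTypes-isEquivalence t c = record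
    { refl  = λ ℓ → ⇔.refl
    ; sym   = λ s ℓ → ⇔.sym (s ℓ)
    ; trans = λ s r ℓ → ⇔.trans (s ℓ) (r ℓ)
    }
    where module ⇔ = IsEquivalence (⇔-isEquivalence {0ℓ})

  sameTypes? : ∀ {w k} (t : Fin n → Fin w) (c : Fin n → Fin k) → ∀ a b → Dec (SameTypes G t c a b)
  sameTypes? t c a b = all? λ ℓ → map′ (λ (f , g) → mk⇔ f g) (λ e → to e , from e)
                                      ((meets? a ℓ →-dec meets? b ℓ) ×-dec (meets? b ℓ →-dec meets? a ℓ))
    where
    meets? : ∀ j ℓ → Dec (Meets G t c j ℓ)
    meets? j ℓ = any? λ v → (c v ≟ j) ×-dec (t v ≟ ℓ)

  module _ {w k} (t : Fin n → Fin w) (c : Fin n → Fin k) (π : Permutation′ k) where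

    meets-permute : ∀ j ℓ → Meets G t ((π ⟨$⟩ʳ_) ∘ c) j ℓ ⇔ Meets G t c (π ⟨$⟩ˡ j) ℓ
    meets-permute j ℓ = mk⇔
      (λ (v , cv , tv) → v , ≡.trans (≡.sym (inverseˡ π)) (cong (π ⟨$⟩ˡ_) cv) , tv)
      (λ (v , cv , tv) → v , ≡.trans (cong (π ⟨$⟩ʳ_) cv) (inverseʳ π) , tv)

    sameTypes-permute : ∀ j₁ j₂ → SameTypes G t ((π ⟨$⟩ʳ_) ∘ c) j₁ j₂ ⇔ SameTypes G t c (π ⟨$⟩ˡ j₁) (π ⟨$⟩ˡ j₂)
    sameTypes-permute j₁ j₂ = mk⇔
      (λ s ℓ → meets-permute j₂ ℓ ⇔-∘ (s ℓ ⇔-∘ ⇔-sym (meets-permute j₁ ℓ)))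
      (λ s ℓ → ⇔-sym (meets-permute j₂ ℓ) ⇔-∘ (s ℓ ⇔-∘ meets-permute j₁ ℓ))

    permute-grundy : IsGrundy G k c
      → (∀ m v → π ⟨$⟩ʳ m < π ⟨$⟩ʳ c v → ∃ λ u → Adj G v u × c u ≡ m)
      → IsGrundy G k ((π ⟨$⟩ʳ_) ∘ c)
    permute-grundy g precedes = record
      { nonempty    = λ i → let v , cv = IsGrundy.nonempty g (π ⟨$⟩ˡ i)
                            in v , ≡.trans (cong (π ⟨$⟩ʳ_) cv) (inverseʳ π)
      ; independent = λ u v uv e → IsGrundy.independent g u v uv
                                     (≡.trans (≡.sym (inverseˡ π)) (≡.trans (cong (π ⟨$⟩ˡ_) e) (inverseˡ π)))
      ; grundy      = λ i v lt → let u , vu , cu = precedes (π ⟨$⟩ˡ i) v (subst (_< _) (≡.sym (inverseʳ π)) lt)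
                                 in u , vu , ≡.trans (cong (π ⟨$⟩ʳ_) cu) (inverseʳ π)
      }

module ReorderByType {n} (G : Graph n) {w} (t : Fin n → Fin w) (TT : TrueTwinPartition G w t)
                     {k} (c : Fin n → Fin k) (g : IsGrundy G k c) where

  Same : Fin k → Fin k → Set
  Same = SameTypes G t c

  open IsEquivalence (sameTypes-isEquivalence G t c)
    renaming (refl to same-refl; sym to same-sym; trans to same-trans)

  -- The first colour having the same type as m.  Only the three properties
  -- below are used; keeping the search abstract stops the type checker from
  -- unfolding it during unification.
  abstract
    first : Fin k → Fin k
    first m = proj₁ (least (λ j → sameTypes? G t c j m) (m , same-refl))

    first-same : ∀ m → Same (first m) m
    first-same m = proj₁ (proj₂ (least (λ j → sameTypes? G t c j m) (m , same-refl)))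

    first-least : ∀ {m j} → Same j m → first m ≤ j
    first-least {m} = proj₂ (proj₂ (least (λ j → sameTypes? G t c j m) (m , same-refl)))

  first-injective : ∀ {a b} → first a ≡ first b → Same a b
  first-injective {a} {b} e = same-trans (same-sym (first-same a)) (subst (λ j → Same j b) (≡.sym e) (first-same b))

  first-cong : ∀ {a b} → Same a b → first a ≡ first b
  first-cong {a} {b} s = ≤-antisym (first-least (same-trans (first-same b) (same-sym s)))
                                   (first-least (same-trans (first-same a) s))

  open KeyOrder first

  π : Permutation′ k
  π = proj₁ (sortingPermutation ≺-isStrictTotalOrder)

  π-sorts : ∀ {a b} → a ≺ b ⇔ π ⟨$⟩ʳ a < π ⟨$⟩ʳ b
  π-sorts = proj₂ (sortingPermutation ≺-isStrictTotalOrder)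

  c′ : Fin n → Fin k
  c′ = (π ⟨$⟩ʳ_) ∘ c

  -- If v sees colour a, and b has the same type as a, then v sees colour b
  -- (unless v itself has colour b): the twin of a neighbour is a neighbour.
  sameType-neighbour : ∀ {a b u v} → Same a b → Adj G v u → c u ≡ a → c v ≢ b
    → ∃ λ u' → Adj G v u' × c u' ≡ b
  sameType-neighbour {u = u} s vu cu cv≢b with to (s (t u)) (u , cu , refl)
  ... | u' , cu' , tu' = u' , twin-adjacent G TT (≡.sym tu') vu (λ { refl → cv≢b cu' }) , cu'

  ≺-neighbour : ∀ m v → m ≺ c v → ∃ λ u → Adj G v u × c u ≡ m
  ≺-neighbour m v m≺cv with <-cmp m (c v)
  ... | tri< m<cv _ _ = IsGrundy.grundy g m v m<cv
  ... | tri≈ _ refl _ = ⊥-elim (IsStrictTotalOrder.irrefl ≺-isStrictTotalOrder refl m≺cv)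
  -- m came after c v before, so first m < first (c v) ≤ c v.
  ... | tri> _ _ cv<m with m≺cv
  ...   | inj₂ (_ , m<cv) = ⊥-elim (<-asym m<cv cv<m)
  ...   | inj₁ fm<fcv with IsGrundy.grundy g (first m) v (ℕ.<-≤-trans fm<fcv (first-least same-refl))
  ...     | u , vu , cu = sameType-neighbour (first-same m) vu cu (λ e → <-irrefl e cv<m)

  c′-grundy : IsGrundy G k c′
  c′-grundy = permute-grundy G t c π g (λ m v lt → ≺-neighbour m v (from π-sorts lt))

  c′-contiguous : ∀ j₁ j₂ j₃ → SameTypes G t c′ j₁ j₂ → j₁ ≤ j₃ → j₃ ≤ j₂ → SameTypes G t c′ j₃ j₁
  c′-contiguous j₁ j₂ j₃ s j₁≤j₃ j₃≤j₂ =
    from (sameTypes-permute G t c π j₃ j₁)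
      (first-injective (key-block (first-cong (to (sameTypes-permute G t c π j₁ j₂) s))
                                  (λ a₃≺a₁ → ℕ.≤⇒≯ j₁≤j₃ (sorted a₃≺a₁))
                                  (λ a₂≺a₃ → ℕ.≤⇒≯ j₃≤j₂ (sorted a₂≺a₃))))
    where
    sorted : ∀ {i j} → π ⟨$⟩ˡ i ≺ π ⟨$⟩ˡ j → i < j
    sorted lt = subst₂ _<_ (inverseʳ π) (inverseʳ π) (to π-sorts lt)

corollary6p3 : ∀ {n : ℕ} (G : Graph n) (w : ℕ) (t : Fin n → Fin w)
    → TrueTwinPartition G w t
    → (k : ℕ)
    → (∃ λ (c : Fin n → Fin k) → IsGrundy G k c)
    → ∃ λ (c : Fin n → Fin k) → IsGrundy G k c
        × (∀ j₁ j₂ j₃ → SameTypes G t c j₁ j₂ → j₁ ≤ j₃ → j₃ ≤ j₂ → SameTypes G t c j₃ j₁)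
corollary6p3 G w t TT k (c , g) = c′ , c′-grundy , c′-contiguous
  where open ReorderByType G t TT c g
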